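{- Let $G$ be a permutation graph with a fixed permutation diagram, and let $S$ be a nonempty convexly independent set of $G$. Let $x$ be a vertex whose segment lies to the right of the last component of $S$. Then $x\in\sigma(S)$ if and only if the segment of $x$ lies to the left of the border of $\sigma(S)$, i.e. its top endpoint is not to the right of the top border point and its bottom endpoint is not to the right of the bottom border point.
   Context: All graphs are finite and simple. A permutation diagram of $G$ represents each vertex by a straight line segment with one endpoint on a top horizontal line and one on a bottom horizontal line (all endpoints distinct); two vertices are adjacent iff their segments cross. A set $C$ of vertices is ($P_3$-)convex if every vertex outside $C$ has at most one neighbor in $C$; $\sigma(A)$ is the smallest convex set containing $A$. A set $S$ is convexly independent if $y\notin\sigma(S\setminus\{y\})$ for all $y\in S$. For such $S$, the components of $G[S]$ (each a vertex or an edge) have mutually non-crossing segments and are thus linearly ordered from left to right in the diagram; the last component of $S$ is the rightmost one. A segment lies to the right of the last component if its top endpoint is to the right of all top endpoints of the last component and its bottom endpoint is to the right of all bottom endpoints of the last component. The border of $\sigma(S)$ is the pair consisting of the rightmost point on the top line and the rightmost point on the bottom line that are endpoints of segments of vertices of $\sigma(S)$. -}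

module Defs where

open import Data.Nat using (ℕ; _<_; _≤_)
open import Data.Fin using (Fin)
open import Data.Fin.Subset using (Subset; _∈_; _∉_; _⊆_)
open import Data.Product using (_×_; ∃; Σ-syntax; ∃-syntax)
open import Data.Sum using (_⊎_)
open import Relation.Nullary using (¬_)
open import Relation.Binary.PropositionalEquality using (_≡_)
open import Function.Definitions using (Injective)

-- A permutation diagram on vertex set Fin n: vertex v is the segment from
-- position (top v) on the top line to position (bot v) on the bottom line.
-- All endpoints on each line are distinct.
record Diagram (n : ℕ) : Set where
  field
    top    : Fin n → ℕ
    bot    : Fin n → ℕ
    topInj : Injective _≡_ _≡_ top
    botInj : Injective _≡_ _≡_ bot
open Diagram public

Adj : ∀ {n} → Diagram n → Fin n → Fin n → Set
Adj D u v = (top D u < top D v × bot D v < bot D u)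
          ⊎ (top D v < top D u × bot D u < bot D v)

Convex : ∀ {n} → Diagram n → Subset n → Set
Convex D C = ∀ v → v ∉ C → ∀ u w → u ∈ C → w ∈ C → Adj D v u → Adj D v w → u ≡ w

-- Membership in σ(A), the smallest convex set containing A
-- (= intersection of all convex supersets of A).
-- A is given as a predicate on vertices.
InHull : ∀ {n} → Diagram n → (Fin n → Set) → Fin n → Set
InHull {n} D A x = (C : Subset n) → Convex D C → (∀ v → A v → v ∈ C) → x ∈ C

Minus : ∀ {n} → Subset n → Fin n → Fin n → Set
Minus S y v = v ∈ S × ¬ (v ≡ y)

ConvInd : ∀ {n} → Diagram n → Subset n → Set
ConvInd D S = ∀ y → y ∈ S → ¬ InHull D (Minus S y) y

data Reach {n} (D : Diagram n) (S : Subset n) : Fin n → Fin n → Set where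
  here : ∀ {u} → u ∈ S → Reach D S u u
  step : ∀ {u v w} → u ∈ S → Adj D u v → Reach D S v w → Reach D S u w

LeftOf : ∀ {n} → Diagram n → Fin n → Fin n → Set
LeftOf D w v = top D w < top D v × bot D w < bot D v

InLastComp : ∀ {n} → Diagram n → Subset n → Fin n → Set
InLastComp D S u = u ∈ S × (∀ v w → Reach D S u v → w ∈ S → ¬ Reach D S u w → LeftOf D w v)

RightOfLast : ∀ {n} → Diagram n → Subset n → Fin n → Set
RightOfLast D S x = ∀ u → InLastComp D S u → LeftOf D u x

-- The segment of x lies to the left of the border of σ(S): its top endpoint
-- is not to the right of the rightmost top endpoint of a vertex of σ(S),
-- and likewise on the bottom line.
LeftOfBorder : ∀ {n} → Diagram n → Subset n → Fin n → Set
LeftOfBorder D S x =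
  (∃[ v ] (InHull D (_∈ S) v × top D x ≤ top D v)) ×
  (∃[ w ] (InHull D (_∈ S) w × bot D x ≤ bot D w))

-- Every vertex of S lies to the left of x: those in the last component by
-- hypothesis, the others because they lie left of the last component, which
-- is the component of the vertex of S with rightmost top endpoint.  Now let
-- C be a convex superset of S with x ∉ C.  The vertices of C that lie left of
-- x or cross x again form a convex superset of S, so it contains the border
-- witnesses v (top x ≤ top v) and w (bot x ≤ bot w).  Neither lies left of x,
-- so both cross x: v has its top endpoint right of that of x, w its bottom
-- endpoint.  Hence v ≢ w, and x ∉ C has two neighbours in C.
module Submission where

open import Defs
open import Data.Nat using (ℕ; _<_; _≤_; _<?_)
open import Data.Nat.Properties
  using (≤-refl; <-trans; <⇒≱; <-asym; ≮⇒≥; ≤∧≢⇒<; ≤-totalOrder)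
open import Data.Fin using (Fin)
open import Data.Fin.Subset using (Subset; _∈_; _∉_)
open import Data.Fin.Subset.Properties using (_∈?_)
open import Data.Product using (_×_; ∃-syntax; _,_; proj₁; proj₂)
open import Data.Sum using (_⊎_; inj₁; inj₂)
open import Data.Bool using (true)
open import Data.Empty using (⊥-elim)
open import Data.List using (List; allFin; filter)
open import Data.List.Extrema ≤-totalOrder using (argmax; argmax-all; f[xs]≤f[argmax])
open import Data.List.Relation.Unary.All using (lookup)
open import Data.List.Relation.Unary.All.Properties using (all-filter)
open import Data.List.Membership.Propositional.Properties using (∈-allFin; ∈-filter⁺)
open import Data.Vec using (tabulate)
open import Data.Vec.Properties using (lookup∘tabulate; lookup⇒[]=; []=⇒lookup)
open import Function using (_∘_)
open import Relation.Unary using (Decidable)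
open import Relation.Nullary using (¬_; Dec; yes; no; does)
open import Relation.Nullary.Decidable using (_×-dec_; _⊎-dec_; decidable-stable; dec-true)
open import Relation.Nullary.Negation using (¬¬-map)
open import Relation.Nullary.Decidable.Core using (¬¬-excluded-middle)
open import Relation.Binary.PropositionalEquality using (_≡_; _≢_; refl; sym; trans)

module _ {n : ℕ} where

  subsetOf : {P : Fin n → Set} → Decidable P → Subset n
  subsetOf P? = tabulate (does ∘ P?)

  module _ {P : Fin n → Set} (P? : Decidable P) {x : Fin n} where

    ∈-subsetOf⁺ : P x → x ∈ subsetOf P?
    ∈-subsetOf⁺ px = lookup⇒[]= x _ (trans (lookup∘tabulate _ x) (dec-true (P? x) px))

    ∈-subsetOf⁻ : x ∈ subsetOf P? → P x
    ∈-subsetOf⁻ x∈ = witness (P? x) (trans (sym (lookup∘tabulate _ x)) ([]=⇒lookup x∈))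
      where
        witness : (d : Dec (P x)) → does d ≡ true → P x
        witness (yes px) _  = px
        witness (no  _)  ()

module _ {n : ℕ} (D : Diagram n) where

  Adj-sym : ∀ {a b} → Adj D a b → Adj D b a
  Adj-sym (inj₁ p) = inj₂ p
  Adj-sym (inj₂ p) = inj₁ p

  LeftOf-trans : ∀ {a b c} → LeftOf D a b → LeftOf D b c → LeftOf D a c
  LeftOf-trans (t , b) (t′ , b′) = <-trans t t′ , <-trans b b′

  LeftOf? : ∀ a b → Dec (LeftOf D a b)
  LeftOf? a b = (top D a <? top D b) ×-dec (bot D a <? bot D b)

  Adj? : ∀ a b → Dec (Adj D a b)
  Adj? a b = (top D a <? top D b ×-dec bot D b <? bot D a)
       ⊎-dec (top D b <? top D a ×-dec bot D a <? bot D b)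

  LeftOf⇒¬Adj : ∀ {a b} → LeftOf D a b → ¬ Adj D a b
  LeftOf⇒¬Adj (_ , ba<bb) (inj₁ (_ , bb<ba)) = <-asym ba<bb bb<ba
  LeftOf⇒¬Adj (ta<tb , _) (inj₂ (tb<ta , _)) = <-asym ta<tb tb<ta

  nonCrossing⇒LeftOf : ∀ {w z} → w ≢ z → ¬ Adj D z w →
                       top D w < top D z ⊎ bot D w < bot D z → LeftOf D w z
  nonCrossing⇒LeftOf w≢z ¬adj (inj₁ tw<tz) =
    tw<tz , ≤∧≢⇒< (≮⇒≥ (λ bz<bw → ¬adj (inj₂ (tw<tz , bz<bw)))) (w≢z ∘ botInj D)
  nonCrossing⇒LeftOf w≢z ¬adj (inj₂ bw<bz) =
    ≤∧≢⇒< (≮⇒≥ (λ tz<tw → ¬adj (inj₁ (tz<tw , bw<bz)))) (w≢z ∘ topInj D) , bw<bz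

  nonCrossing-LeftOf-total : ∀ {x y} → x ≢ y → ¬ Adj D y x → ¬ LeftOf D y x → LeftOf D x y
  nonCrossing-LeftOf-total {x} {y} x≢y ¬adj ¬y<x = nonCrossing⇒LeftOf x≢y ¬adj (inj₁ tx<ty)
    where
      tx<ty : top D x < top D y
      tx<ty = ≤∧≢⇒< (≮⇒≥ (λ ty<tx → ¬y<x (nonCrossing⇒LeftOf (x≢y ∘ sym) (¬adj ∘ Adj-sym) (inj₁ ty<tx))))
                    (x≢y ∘ topInj D)

  LeftOf-Adj-apart : ∀ {w a b} → LeftOf D w a → Adj D a b → top D w < top D b ⊎ bot D w < bot D b
  LeftOf-Adj-apart (tw<ta , _) (inj₁ (ta<tb , _)) = inj₁ (<-trans tw<ta ta<tb)
  LeftOf-Adj-apart (_ , bw<ba) (inj₂ (_ , ba<bb)) = inj₂ (<-trans bw<ba ba<bb)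

  module _ (S : Subset n) where

    Reach-start : ∀ {a b} → Reach D S a b → a ∈ S
    Reach-start (here a∈S)     = a∈S
    Reach-start (step a∈S _ _) = a∈S

    Reach-snoc : ∀ {a b c} → Reach D S a b → Adj D b c → c ∈ S → Reach D S a c
    Reach-snoc (here b∈S)        b~c c∈S = step b∈S b~c (here c∈S)
    Reach-snoc (step a∈S a~a′ r) b~c c∈S = step a∈S a~a′ (Reach-snoc r b~c c∈S)

    Reach-trans : ∀ {a b c} → Reach D S a b → Reach D S b c → Reach D S a c
    Reach-trans (here _)          r′ = r′
    Reach-trans (step a∈S a~a′ r) r′ = step a∈S a~a′ (Reach-trans r r′)

    Reach-sym : ∀ {a b} → Reach D S a b → Reach D S b a
    Reach-sym (here a∈S)        = here a∈S
    Reach-sym (step a∈S a~a′ r) = Reach-snoc (Reach-sym r) (Adj-sym a~a′) a∈S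

    LeftOf-Reach : ∀ {w a v} → Reach D S a v → LeftOf D w a →
                   (∀ z → Reach D S a z → ¬ Adj D z w) → LeftOf D w v
    LeftOf-Reach (here _) w<a _ = w<a
    LeftOf-Reach {w} {a} (step {v = a′} a∈S a~a′ r) w<a noCross =
      LeftOf-Reach r w<a′ (λ z r′ → noCross z (step a∈S a~a′ r′))
      where
        w≢a′ : w ≢ a′
        w≢a′ refl = noCross a (here a∈S) a~a′
        w<a′ : LeftOf D w a′
        w<a′ = nonCrossing⇒LeftOf w≢a′ (noCross a′ (step a∈S a~a′ (here (Reach-start r))))
                                   (LeftOf-Adj-apart w<a a~a′)

    topmost-InLastComp : ∀ {y} → y ∈ S → ∃[ u ] InLastComp D S u
    topmost-InLastComp {y} y∈S = u , u∈S , lastComp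
      where
        members : List (Fin n)
        members = filter (_∈? S) (allFin n)
        u : Fin n
        u = argmax (top D) y members
        u∈S : u ∈ S
        u∈S = argmax-all (top D) y∈S (all-filter (_∈? S) (allFin n))
        top≤top-u : ∀ {w} → w ∈ S → top D w ≤ top D u
        top≤top-u {w} w∈S =
          lookup (f[xs]≤f[argmax] y members) (∈-filter⁺ (_∈? S) (∈-allFin w) w∈S)
        lastComp : ∀ v w → Reach D S u v → w ∈ S → ¬ Reach D S u w → LeftOf D w v
        lastComp v w u↝v w∈S u↛w = LeftOf-Reach u↝v w<u (λ z u↝z z~w → u↛w (Reach-snoc u↝z z~w w∈S))
          where
            w≢u : w ≢ u
            w≢u refl = u↛w (here u∈S)
            w<u : LeftOf D w u
            w<u = nonCrossing⇒LeftOf w≢u (λ u~w → u↛w (step u∈S u~w (here w∈S)))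
                                     (inj₁ (≤∧≢⇒< (top≤top-u w∈S) (w≢u ∘ topInj D)))

    InLastComp-Reach : ∀ {u s} → InLastComp D S u → Reach D S u s → InLastComp D S s
    InLastComp-Reach (_ , last) u↝s =
      Reach-start (Reach-sym u↝s) ,
      λ v w s↝v w∈S s↛w → last v w (Reach-trans u↝s s↝v) w∈S (s↛w ∘ Reach-trans (Reach-sym u↝s))

    -- Reachability in G[S] is not decided here, so case on it under ¬¬ and
    -- conclude by stability of the decidable LeftOf.
    RightOfLast⇒LeftOf : ∀ {x y} → y ∈ S → RightOfLast D S x → ∀ s → s ∈ S → LeftOf D s x
    RightOfLast⇒LeftOf {x} y∈S x-right s s∈S =
      decidable-stable (LeftOf? s x) (¬¬-map byComponent ¬¬-excluded-middle)
      where
        u : Fin n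
        u = proj₁ (topmost-InLastComp y∈S)
        last : InLastComp D S u
        last = proj₂ (topmost-InLastComp y∈S)
        byComponent : Dec (Reach D S u s) → LeftOf D s x
        byComponent (yes u↝s) = x-right s (InLastComp-Reach last u↝s)
        byComponent (no u↛s)  =
          LeftOf-trans (proj₂ last u s (here (proj₁ last)) s∈S u↛s) (x-right u last)

  module _ {C : Subset n} {x : Fin n} (C-convex : Convex D C) (x∉C : x ∉ C) where

    Shadow : Fin n → Set
    Shadow h = h ∈ C × (LeftOf D h x ⊎ Adj D h x)

    Shadow? : Decidable Shadow
    Shadow? h = (h ∈? C) ×-dec (LeftOf? h x ⊎-dec Adj? h x)

    shadow-convex : Convex D (subsetOf Shadow?)
    shadow-convex y y∉ a b a∈ b∈ y~a y~b with y ∈? C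
    ... | no y∉C  = C-convex y y∉C a b (proj₁ (∈-subsetOf⁻ Shadow? a∈)) (proj₁ (∈-subsetOf⁻ Shadow? b∈)) y~a y~b
    ... | yes y∈C = C-convex x x∉C a b (proj₁ (∈-subsetOf⁻ Shadow? a∈)) (proj₁ (∈-subsetOf⁻ Shadow? b∈))
                      (crosses-x a∈ y~a) (crosses-x b∈ y~b)
      where
        y∉Shadow : ¬ (LeftOf D y x ⊎ Adj D y x)
        y∉Shadow p = y∉ (∈-subsetOf⁺ Shadow? (y∈C , p))
        x<y : LeftOf D x y
        x<y = nonCrossing-LeftOf-total {x} {y} (λ { refl → x∉C y∈C }) (y∉Shadow ∘ inj₂) (y∉Shadow ∘ inj₁)
        crosses-x : ∀ {a} → a ∈ subsetOf Shadow? → Adj D y a → Adj D x a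
        crosses-x {a} a∈ y~a with proj₂ (∈-subsetOf⁻ Shadow? a∈)
        ... | inj₁ a<x = ⊥-elim (LeftOf⇒¬Adj (LeftOf-trans a<x x<y) (Adj-sym y~a))
        ... | inj₂ a~x = Adj-sym a~x

    shadow-right-of-top : ∀ {h} → Shadow h → top D x ≤ top D h → top D x < top D h × bot D h < bot D x
    shadow-right-of-top (_ , inj₁ (th<tx , _))        tx≤th = ⊥-elim (<⇒≱ th<tx tx≤th)
    shadow-right-of-top (_ , inj₂ (inj₁ (th<tx , _))) tx≤th = ⊥-elim (<⇒≱ th<tx tx≤th)
    shadow-right-of-top (_ , inj₂ (inj₂ crossing))    _     = crossing

    shadow-right-of-bot : ∀ {h} → Shadow h → bot D x ≤ bot D h → top D h < top D x × bot D x < bot D h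
    shadow-right-of-bot (_ , inj₁ (_ , bh<bx))        bx≤bh = ⊥-elim (<⇒≱ bh<bx bx≤bh)
    shadow-right-of-bot (_ , inj₂ (inj₁ crossing))    _     = crossing
    shadow-right-of-bot (_ , inj₂ (inj₂ (_ , bh<bx))) bx≤bh = ⊥-elim (<⇒≱ bh<bx bx≤bh)

    hull⊆shadow : ∀ {S h} → (∀ s → s ∈ S → Shadow s) → InHull D (_∈ S) h → Shadow h
    hull⊆shadow S⊆Shadow h∈σ =
      ∈-subsetOf⁻ Shadow? (h∈σ _ shadow-convex (λ s → ∈-subsetOf⁺ Shadow? ∘ S⊆Shadow s))

    border-excludes : ∀ {S} → (∀ s → s ∈ S → Shadow s) → ¬ LeftOfBorder D S x
    border-excludes S⊆Shadow ((v , v∈σ , tx≤tv) , (w , w∈σ , bx≤bw))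
      = v≢w (C-convex x x∉C v w (proj₁ v∈Shadow) (proj₁ w∈Shadow) (inj₁ x~v) (inj₂ x~w))
      where
        v∈Shadow : Shadow v
        v∈Shadow = hull⊆shadow S⊆Shadow v∈σ
        w∈Shadow : Shadow w
        w∈Shadow = hull⊆shadow S⊆Shadow w∈σ
        x~v : top D x < top D v × bot D v < bot D x
        x~v = shadow-right-of-top v∈Shadow tx≤tv
        x~w : top D w < top D x × bot D x < bot D w
        x~w = shadow-right-of-bot w∈Shadow bx≤bw
        v≢w : v ≢ w
        v≢w refl = <-asym (proj₂ x~v) (proj₂ x~w)

mainTheorem9 : ∀ {n} (D : Diagram n) (S : Subset n) → (∃[ y ] y ∈ S) → ConvInd D S
    → (x : Fin n) → RightOfLast D S x
    → (InHull D (_∈ S) x → LeftOfBorder D S x) × (LeftOfBorder D S x → InHull D (_∈ S) x)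
mainTheorem9 D S (y , y∈S) _ x x-right = (λ x∈σ → (x , x∈σ , ≤-refl) , (x , x∈σ , ≤-refl)) , inHull
  where
    inHull : LeftOfBorder D S x → InHull D (_∈ S) x
    inHull border C C-convex S⊆C with x ∈? C
    ... | yes x∈C = x∈C
    ... | no  x∉C = ⊥-elim (border-excludes D C-convex x∉C
                      (λ s s∈S → S⊆C s s∈S , inj₁ (RightOfLast⇒LeftOf D S y∈S x-right s s∈S)) border)
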